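{- For every fixed $p\in(0,1)$, the total time that pdqsort (as described in the context) spends on good partitions when sorting an array of length $n$ is $O(n\log n)$; here the time spent on good partitions is the sum, over all calls whose partition step is good (not bad), of the work done in that call excluding its recursive calls.
   Context: Setting. The input is an array $A[0..n-1]$ ($n\ge1$) of elements compared by a strict weak ordering $<$; $a,b$ compare equal if neither $a<b$ nor $b<a$; $a\le b$ means "not $b<a$". Time counts elementary operations, each comparison or element move costing $O(1)$. pdqsort has fixed constants: insertion-sort threshold $c\ge3$, bad-partition parameter $p\in(0,1)$, and a constant move bound. It is the following recursive procedure acting in place on contiguous subarrays $A[a..b)$, each call carrying an integer counter $t$; the top-level call is on $A[0..n)$ with $t=\lfloor\log_2 n\rfloor$. For $a>0$ the predecessor of $A[a..b)$ is the element at position $a-1$. A call on $A[a..b)$ with $m=b-a$ does: (1) if $m\le c$, insertion sort $A[a..b)$ and return; (2) if $t=0$, heapsort $A[a..b)$ and return; (3) select a pivot $q$ as the median of at least three sampled elements of $A[a..b)$ by a deterministic rule using $O(1)$ comparisons, and move it to position $a$; (4) if $a>0$ and the predecessor compares equal to $q$, apply partition_left: in $O(m)$ time rearrange so that $q$ ends at a position $r$, all of $A[a..r)$ are $\le q$, all of $A[r+1..b)$ are $>q$; otherwise apply partition_right: in $O(m)$ time rearrange so that $q$ ends at $r$, all of $A[a..r)$ are $<q$, all of $A[r+1..b)$ are $\ge q$; (5) the partition is bad if $\min(r-a,b-r-1)<pm$, good otherwise; if bad, set $t:=t-1$ and swap $O(1)$ elements at fixed relative positions inside each part; (6) if partition_right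 was applied, the partition is good, and no element other than the pivot was moved, run on both parts an insertion sort aborting after the constant number of moves; if both complete, return; (7) if partition_left was applied, recurse only on $A[r+1..b)$; otherwise recurse on $A[a..r)$ and on $A[r+1..b)$, each with counter $t$. The counter is local to each call, not global.
   Formalization: The bad-partition parameter $p\in(0,1)$ is taken rational. -}

module Defs where

open import Data.Nat using (ℕ; zero; suc; _+_; _*_; _∸_; _≤_; _<_; _⊓_)
open import Data.Fin using (Fin; toℕ)
open import Data.Product using (Σ; _×_; _,_)
open import Data.Sum using (_⊎_)
open import Relation.Nullary using (¬_)
open import Relation.Binary.PropositionalEquality using (_≡_)
open import Function.Definitions using (Injective)

Incomparable : {A : Set} → (A → A → Set) → A → A → Set
Incomparable _≺_ x y = ¬ (x ≺ y) × ¬ (y ≺ x)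

record StrictWeakOrder {A : Set} (_≺_ : A → A → Set) : Set where
  field
    irrefl     : ∀ x → ¬ (x ≺ x)
    trans      : ∀ {x y z} → x ≺ y → y ≺ z → x ≺ z
    incomp-trans : ∀ {x y z} → Incomparable _≺_ x y → Incomparable _≺_ y z →
                   Incomparable _≺_ x z

-- Arrays of length n are functions Fin n → A; positions are compared as
-- naturals via toℕ.  A subarray A[a..b) is given by the naturals a, b.

Arr : Set → ℕ → Set
Arr A n = Fin n → A

PermOn : {A : Set} {n : ℕ} → ℕ → ℕ → Arr A n → Arr A n → Set
PermOn {n = n} a b X Y =
  Σ (Fin n → Fin n) λ σ →
    Injective _≡_ _≡_ σ
    × (∀ i → (toℕ i < a ⊎ b ≤ toℕ i) → σ i ≡ i)
    × (∀ i → Y i ≡ X (σ i))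

SortedOn : {A : Set} {n : ℕ} → (A → A → Set) → ℕ → ℕ → Arr A n → Set
SortedOn _≺_ a b X =
  ∀ i j → a ≤ toℕ i → toℕ i < toℕ j → toℕ j < b → ¬ (X j ≺ X i)

At : {A : Set} {n : ℕ} → ℕ → Arr A n → A → Set
At k X q = ∀ i → toℕ i ≡ k → X i ≡ q

-- pdqsort, as a relation describing all executions allowed by the
-- description in the paper.  Parameters:
--   _≺_      the strict weak ordering,
--   c        insertion-sort threshold,
--   num den  the bad-partition parameter p = num / den,
--   C        the constant in the O(m) bound on the work of one call
--            (pivot selection, partitioning, the O(1) swaps and the
--            aborting partial insertion sorts) excluding recursive calls.
--
-- Exec t a b X Y w : the call on A[a..b) with counter t, started on array
-- X, may finish with array Y, and the total work spent in this call and its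
-- descendants on calls whose partition is GOOD is w.

module PDQ {A : Set} (_≺_ : A → A → Set) (c num den C : ℕ) where

  Bad : ℕ → ℕ → ℕ → Set
  Bad a r b = den * ((r ∸ a) ⊓ (b ∸ suc r)) < num * (b ∸ a)

  Good : ℕ → ℕ → ℕ → Set
  Good a r b = num * (b ∸ a) ≤ den * ((r ∸ a) ⊓ (b ∸ suc r))

  PredEq : {n : ℕ} → ℕ → Arr A n → A → Set
  PredEq {n} a X q = Σ (Fin n) λ i → suc (toℕ i) ≡ a × Incomparable _≺_ (X i) q

  PartLeft : {n : ℕ} → ℕ → ℕ → ℕ → A → Arr A n → Arr A n → Set
  PartLeft a b r q X Y =
    PermOn a b X Y × a ≤ r × r < b × At r Y q
    × (∀ i → a ≤ toℕ i → toℕ i < r → ¬ (q ≺ Y i))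
    × (∀ i → r < toℕ i → toℕ i < b → q ≺ Y i)

  PartRight : {n : ℕ} → ℕ → ℕ → ℕ → A → Arr A n → Arr A n → Set
  PartRight a b r q X Y =
    PermOn a b X Y × a ≤ r × r < b × At r Y q
    × (∀ i → a ≤ toℕ i → toℕ i < r → Y i ≺ q)
    × (∀ i → r < toℕ i → toℕ i < b → ¬ (Y i ≺ q))

  PermParts : {n : ℕ} → ℕ → ℕ → ℕ → Arr A n → Arr A n → Set
  PermParts {n} a r b X Y = Σ (Arr A n) λ Z → PermOn a r X Z × PermOn (suc r) b Z Y

  data Mode : Set where
    left right : Mode

  -- Step (5) (and, for a good partition_right, the aborted insertion sorts
  -- of step (6)): from the partitioned array X, the array Y passed on to the
  -- recursive calls, the new counter, and the local work counted as
  -- good-partition time.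
  data AfterPartition {n : ℕ} (mo : Mode) (t a r b : ℕ) (X : Arr A n)
       : Arr A n → ℕ → ℕ → Set where
    good-left  : ∀ {w} → mo ≡ left → Good a r b → w ≤ C * (b ∸ a) →
                 AfterPartition mo t a r b X X t w
    good-right : ∀ {w Y} → mo ≡ right → Good a r b → w ≤ C * (b ∸ a) →
                 PermParts a r b X Y →   -- aborted partial insertion sorts
                 AfterPartition mo t a r b X Y t w
    bad        : ∀ {Y} → Bad a r b → PermParts a r b X Y →  -- the O(1) swaps
                 AfterPartition mo t a r b X Y (t ∸ 1) 0

  data Exec {n : ℕ} : ℕ → ℕ → ℕ → Arr A n → Arr A n → ℕ → Set where
    insertion : ∀ {t a b X Y} → b ∸ a ≤ c →
                PermOn a b X Y → SortedOn _≺_ a b Y → Exec t a b X Y 0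
    heap      : ∀ {a b X Y} → c < b ∸ a →
                PermOn a b X Y → SortedOn _≺_ a b Y → Exec 0 a b X Y 0
    part-left : ∀ {t a b r q X X₁ X₂ X₃ Y t' w k} → c < b ∸ a →
                PermOn a b X X₁ → At a X₁ q →
                PredEq a X₁ q →                        -- (4) choose partition_left
                PartLeft a b r q X₁ X₂ →
                AfterPartition left (suc t) a r b X₂ X₃ t' w →
                Exec t' (suc r) b X₃ Y k →
                Exec (suc t) a b X Y (w + k)
    -- (3)(4) partition_right, good, (6) both partial insertion sorts complete
    part-right-done : ∀ {t a b r q X X₁ X₂ Y w} → c < b ∸ a →
                PermOn a b X X₁ → At a X₁ q →
                ¬ PredEq a X₁ q →
                PartRight a b r q X₁ X₂ →
                Good a r b → w ≤ C * (b ∸ a) →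
                PermParts a r b X₂ Y → SortedOn _≺_ a r Y → SortedOn _≺_ (suc r) b Y →
                Exec (suc t) a b X Y w
    part-right : ∀ {t a b r q X X₁ X₂ X₃ Z Y t' w k₁ k₂} → c < b ∸ a →
                PermOn a b X X₁ → At a X₁ q →
                ¬ PredEq a X₁ q →
                PartRight a b r q X₁ X₂ →
                AfterPartition right (suc t) a r b X₂ X₃ t' w →
                Exec t' a r X₃ Z k₁ →
                Exec t' (suc r) b Z Y k₂ →
                Exec (suc t) a b X Y (w + (k₁ + k₂))

-- Let den = 1 + x be the denominator of p.  A good partition of an interval of
-- length m leaves each part of length at most (x / (1 + x)) m, and
-- (1 + 1/x) ^ (1 + x) ≥ 2, so each part has at most half the size measure
-- m ^ (1 + x).  Hence, if m ^ (1 + x) ≤ 2 ^ j, every chain of nested good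
-- calls below the interval has length at most j, and since sibling intervals
-- are disjoint the good-partition work is at most C · m · j.  For the whole
-- array j = (1 + x)(1 + ⌊log₂ n⌋) suffices.
module Submission where

open import Defs
open import Data.Nat
  using (ℕ; zero; suc; _+_; _*_; _∸_; _^_; _≤_; _<_; _⊓_; z≤n; s≤s; NonZero; >-nonZero)
open import Data.Nat.Properties
open import Data.Nat.Logarithm using (⌊log₂_⌋; ⌊log₂⌋-mono-≤; ⌊log₂[2^n]⌋≡n)
open import Data.Nat.Tactic.RingSolver using (solve-∀)
open import Data.Fin using (Fin)
open import Data.Product using (∃-syntax; _×_; _,_; proj₁; proj₂)
open import Relation.Binary.PropositionalEquality
  using (_≡_; refl; sym; trans; cong; module ≡-Reasoning)
open import Data.Empty using (⊥-elim)

^-distribʳ-* : ∀ m n o → (m * n) ^ o ≡ m ^ o * n ^ o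
^-distribʳ-* m n zero    = refl
^-distribʳ-* m n (suc o) rewrite ^-distribʳ-* m n o = interchange m n (m ^ o) (n ^ o)
  where
  interchange : ∀ a b c d → a * b * (c * d) ≡ a * c * (b * d)
  interchange = solve-∀

-- The first two terms of the binomial expansion of (1 + x) ^ k, multiplied by x.
^-bernoulli : ∀ x k → x ^ k * (x + k) ≤ suc x ^ k * x
^-bernoulli x zero = ≤-reflexive (+-identityʳ (x + 0))
^-bernoulli x (suc k) = begin
  x ^ suc k * (x + suc k)    ≡⟨ e₁ x (x ^ k) k ⟩
  x ^ k * (x * (x + suc k))  ≤⟨ *-monoʳ-≤ (x ^ k) x[x+1+k]≤[1+x][x+k] ⟩
  x ^ k * (suc x * (x + k))  ≡⟨ e₂ x (x ^ k) k ⟩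
  suc x * (x ^ k * (x + k))  ≤⟨ *-monoʳ-≤ (suc x) (^-bernoulli x k) ⟩
  suc x * (suc x ^ k * x)    ≡⟨ *-assoc (suc x) (suc x ^ k) x ⟨
  suc x ^ suc k * x          ∎
  where
  open ≤-Reasoning
  e₁ : ∀ a p k → a * p * (a + suc k) ≡ p * (a * (a + suc k))
  e₁ = solve-∀
  e₂ : ∀ a p k → p * (suc a * (a + k)) ≡ suc a * (p * (a + k))
  e₂ = solve-∀
  expand : ∀ a k → suc a * (a + k) ≡ a * (a + suc k) + k
  expand = solve-∀
  x[x+1+k]≤[1+x][x+k] : x * (x + suc k) ≤ suc x * (x + k)
  x[x+1+k]≤[1+x][x+k] = ≤-trans (m≤m+n _ k) (≤-reflexive (sym (expand x k)))

2*x^k≤[1+x]^k : ∀ {x k} .{{_ : NonZero x}} → x ≤ k → 2 * x ^ k ≤ suc x ^ k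
2*x^k≤[1+x]^k {x} {k} x≤k = *-cancelʳ-≤ (2 * x ^ k) (suc x ^ k) x (begin
  2 * x ^ k * x    ≡⟨ rearrange (x ^ k) x ⟩
  x ^ k * (x + x)  ≤⟨ *-monoʳ-≤ (x ^ k) (+-monoʳ-≤ x x≤k) ⟩
  x ^ k * (x + k)  ≤⟨ ^-bernoulli x k ⟩
  suc x ^ k * x    ∎)
  where
  open ≤-Reasoning
  rearrange : ∀ p a → 2 * p * a ≡ p * (a + a)
  rearrange = solve-∀

[1+x]*m₁≤x*m⇒2*m₁^[1+x]≤m^[1+x] : ∀ x {m₁ m} → suc x * m₁ ≤ x * m → 2 * m₁ ^ suc x ≤ m ^ suc x
[1+x]*m₁≤x*m⇒2*m₁^[1+x]≤m^[1+x] zero {zero} _ = z≤n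
[1+x]*m₁≤x*m⇒2*m₁^[1+x]≤m^[1+x] x@(suc _) {m₁} {m} [1+x]m₁≤xm =
  *-cancelˡ-≤ (d ^ d) {{m^n≢0 d d}} (begin
    d ^ d * (2 * m₁ ^ d)  ≡⟨ e₁ (d ^ d) (m₁ ^ d) ⟩
    2 * (d ^ d * m₁ ^ d)  ≡⟨ cong (2 *_) (^-distribʳ-* d m₁ d) ⟨
    2 * (d * m₁) ^ d      ≤⟨ *-monoʳ-≤ 2 (^-monoˡ-≤ d [1+x]m₁≤xm) ⟩
    2 * (x * m) ^ d       ≡⟨ cong (2 *_) (^-distribʳ-* x m d) ⟩
    2 * (x ^ d * m ^ d)   ≡⟨ *-assoc 2 (x ^ d) (m ^ d) ⟨
    2 * x ^ d * m ^ d     ≤⟨ *-monoˡ-≤ (m ^ d) (2*x^k≤[1+x]^k (n≤1+n x)) ⟩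
    d ^ d * m ^ d         ∎)
  where
  open ≤-Reasoning
  d = suc x
  e₁ : ∀ p q → p * (2 * q) ≡ 2 * (p * q)
  e₁ = solve-∀

m≡1+m₁+m₂⇒[1+d]*m₁≤d*m : ∀ d {m₁ m₂ m} → m ≡ suc (m₁ + m₂) → m ≤ suc d * m₂ → suc d * m₁ ≤ d * m
m≡1+m₁+m₂⇒[1+d]*m₁≤d*m d {m₁} {m₂} {m} refl m≤[1+d]m₂ = +-cancelˡ-≤ m _ _ (begin
  m + suc d * m₁                   ≡⟨ +-comm m _ ⟩
  suc d * m₁ + m                   ≤⟨ +-monoʳ-≤ (suc d * m₁) m≤[1+d]m₂ ⟩
  suc d * m₁ + suc d * m₂          ≤⟨ m≤m+n _ (suc d) ⟩
  suc d * m₁ + suc d * m₂ + suc d  ≡⟨ expand d m₁ m₂ ⟩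
  m + d * m                        ∎)
  where
  open ≤-Reasoning
  expand : ∀ d m₁ m₂ → suc d * m₁ + suc d * m₂ + suc d ≡ suc (m₁ + m₂) + d * suc (m₁ + m₂)
  expand = solve-∀

∸-split : ∀ {a r b} → a ≤ r → r < b → b ∸ a ≡ suc ((r ∸ a) + (b ∸ suc r))
∸-split {a} {r} {b} a≤r r<b = begin
  b ∸ a                          ≡⟨ cong (_∸ a) (m+[n∸m]≡n (<⇒≤ r<b)) ⟨
  (r + (b ∸ r)) ∸ a              ≡⟨ +-∸-comm (b ∸ r) a≤r ⟩
  (r ∸ a) + (b ∸ r)              ≡⟨ cong ((r ∸ a) +_) (+-∸-assoc 1 r<b) ⟩
  (r ∸ a) + suc (b ∸ suc r)      ≡⟨ +-suc (r ∸ a) (b ∸ suc r) ⟩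
  suc ((r ∸ a) + (b ∸ suc r))    ∎
  where open ≡-Reasoning

m^[1+x]≤2^j⇒1≤j : ∀ {m x j} → 2 ≤ m → m ^ suc x ≤ 2 ^ j → 1 ≤ j
m^[1+x]≤2^j⇒1≤j {m@(suc _)} {x} {zero} 2≤m m^[1+x]≤1 =
  ⊥-elim (<⇒≱ 2≤m (≤-trans (m≤m*n m (m ^ x) {{m^n≢0 m x}}) m^[1+x]≤1))
m^[1+x]≤2^j⇒1≤j {j = suc _} _ _ = s≤s z≤n

*-sum-≤ : ∀ C {m₁ m₂ m j k₁ k₂} → m₁ + m₂ ≤ m → k₁ ≤ C * m₁ * j → k₂ ≤ C * m₂ * j →
          k₁ + k₂ ≤ C * m * j
*-sum-≤ C {m₁} {m₂} {m} {j} m₁+m₂≤m k₁≤ k₂≤ = begin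
  _                        ≤⟨ +-mono-≤ k₁≤ k₂≤ ⟩
  C * m₁ * j + C * m₂ * j  ≡⟨ distrib C m₁ m₂ j ⟩
  C * (m₁ + m₂) * j        ≤⟨ *-monoˡ-≤ j (*-monoʳ-≤ C m₁+m₂≤m) ⟩
  C * m * j                ∎
  where
  open ≤-Reasoning
  distrib : ∀ C a b j → C * a * j + C * b * j ≡ C * (a + b) * j
  distrib = solve-∀

n<2^[1+⌊log₂n⌋] : ∀ n → n < 2 ^ suc ⌊log₂ n ⌋
n<2^[1+⌊log₂n⌋] n = ≰⇒> λ 2^[1+L]≤n →
  1+n≰n (≤-trans (≤-reflexive (sym (⌊log₂[2^n]⌋≡n (suc ⌊log₂ n ⌋)))) (⌊log₂⌋-mono-≤ 2^[1+L]≤n))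

n^k≤2^[k*[1+⌊log₂n⌋]] : ∀ n k → n ^ k ≤ 2 ^ (k * suc ⌊log₂ n ⌋)
n^k≤2^[k*[1+⌊log₂n⌋]] n k = begin
  n ^ k                   ≤⟨ ^-monoˡ-≤ k (<⇒≤ (n<2^[1+⌊log₂n⌋] n)) ⟩
  (2 ^ suc L) ^ k         ≡⟨ ^-*-assoc 2 (suc L) k ⟩
  2 ^ (suc L * k)         ≡⟨ cong (2 ^_) (*-comm (suc L) k) ⟩
  2 ^ (k * suc L)         ∎
  where
  open ≤-Reasoning
  L = ⌊log₂ n ⌋

2≤n⇒1≤⌊log₂n⌋ : ∀ {n} → 2 ≤ n → 1 ≤ ⌊log₂ n ⌋
2≤n⇒1≤⌊log₂n⌋ 2≤n = ≤-trans (≤-reflexive (sym (⌊log₂[2^n]⌋≡n 1))) (⌊log₂⌋-mono-≤ 2≤n)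

module GoodPartitionWork
  {A : Set} (_≺_ : A → A → Set) (c num x C : ℕ) (1≤c : 1 ≤ c) (1≤num : 1 ≤ num) where
  open PDQ _≺_ c num (suc x) C

  WithinBudget : ℕ → ℕ → Set
  WithinBudget m w = ∀ j → m ^ suc x ≤ 2 ^ j → w ≤ C * m * j

  module _ {a r b : ℕ} (a≤r : a ≤ r) (r<b : r < b) where
    private
      m  = b ∸ a
      m₁ = r ∸ a
      m₂ = b ∸ suc r

    parts+1≡length : m ≡ suc (m₁ + m₂)
    parts+1≡length = ∸-split a≤r r<b

    parts≤length : m₁ + m₂ ≤ m
    parts≤length = ≤-trans (n≤1+n _) (≤-reflexive (sym parts+1≡length))

    bad-within-budget : ∀ {k₁ k₂} →
      WithinBudget m₁ k₁ → WithinBudget m₂ k₂ → WithinBudget m (k₁ + k₂)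
    bad-within-budget k₁-ok k₂-ok j m^[1+x]≤2^j = *-sum-≤ C parts≤length
      (k₁-ok j (≤-trans (^-monoˡ-≤ (suc x) (≤-trans (m≤m+n m₁ m₂) parts≤length)) m^[1+x]≤2^j))
      (k₂-ok j (≤-trans (^-monoˡ-≤ (suc x) (≤-trans (m≤n+m m₂ m₁) parts≤length)) m^[1+x]≤2^j))

    Good⇒parts-halve : Good a r b → 2 * m₁ ^ suc x ≤ m ^ suc x × 2 * m₂ ^ suc x ≤ m ^ suc x
    Good⇒parts-halve good =
      halves parts+1≡length (m⊓n≤n m₁ m₂) ,
      halves (trans parts+1≡length (cong suc (+-comm m₁ m₂))) (m⊓n≤m m₁ m₂)
      where
      halves : ∀ {mᵢ mⱼ} → m ≡ suc (mᵢ + mⱼ) → m₁ ⊓ m₂ ≤ mⱼ → 2 * mᵢ ^ suc x ≤ m ^ suc x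
      halves m≡1+mᵢ+mⱼ ⊓≤mⱼ = [1+x]*m₁≤x*m⇒2*m₁^[1+x]≤m^[1+x] x
        (m≡1+m₁+m₂⇒[1+d]*m₁≤d*m x m≡1+mᵢ+mⱼ (begin
          m                   ≤⟨ m≤n*m m num {{>-nonZero 1≤num}} ⟩
          num * m             ≤⟨ good ⟩
          suc x * (m₁ ⊓ m₂)   ≤⟨ *-monoʳ-≤ (suc x) ⊓≤mⱼ ⟩
          suc x * _           ∎))
        where open ≤-Reasoning

    good-within-budget : ∀ {w k₁ k₂} → c < m → Good a r b → w ≤ C * m →
      WithinBudget m₁ k₁ → WithinBudget m₂ k₂ → WithinBudget m (w + (k₁ + k₂))
    good-within-budget {w} {k₁} {k₂} c<m good w≤Cm k₁-ok k₂-ok j m^[1+x]≤2^j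
      with m^[1+x]≤2^j⇒1≤j {m} {x} {j} (≤-trans (s≤s 1≤c) c<m) m^[1+x]≤2^j
    ... | s≤s {n = j′} _ = begin
      w + (k₁ + k₂)        ≤⟨ +-monoʳ-≤ w (*-sum-≤ C parts≤length
                                (k₁-ok j′ (halved m₁ (proj₁ (Good⇒parts-halve good))))
                                (k₂-ok j′ (halved m₂ (proj₂ (Good⇒parts-halve good))))) ⟩
      w + C * m * j′       ≤⟨ +-monoˡ-≤ (C * m * j′) w≤Cm ⟩
      C * m + C * m * j′   ≡⟨ *-suc (C * m) j′ ⟨
      C * m * suc j′       ∎
      where
      open ≤-Reasoning
      halved : ∀ mᵢ → 2 * mᵢ ^ suc x ≤ m ^ suc x → mᵢ ^ suc x ≤ 2 ^ j′
      halved _ halves = *-cancelˡ-≤ 2 (≤-trans halves m^[1+x]≤2^j)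

    after-partition-within-budget : ∀ {n mo t t′ w k₁ k₂} {X Y : Arr A n} → c < m →
      AfterPartition mo t a r b X Y t′ w →
      WithinBudget m₁ k₁ → WithinBudget m₂ k₂ → WithinBudget m (w + (k₁ + k₂))
    after-partition-within-budget c<m (good-left _ good w≤Cm)    = good-within-budget c<m good w≤Cm
    after-partition-within-budget c<m (good-right _ good w≤Cm _) = good-within-budget c<m good w≤Cm
    after-partition-within-budget c<m (bad _ _)                  = bad-within-budget

  exec-within-budget : ∀ {n t a b w} {X Y : Arr A n} → Exec t a b X Y w → WithinBudget (b ∸ a) w
  exec-within-budget (insertion _ _ _) _ _ = z≤n
  exec-within-budget (heap _ _ _)      _ _ = z≤n
  exec-within-budget (part-left c<m _ _ _ (_ , a≤r , r<b , _) after rest) =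
    after-partition-within-budget a≤r r<b c<m after (λ _ _ → z≤n) (exec-within-budget rest)
  exec-within-budget (part-right-done {a = a} {b} c<m _ _ _ _ _ w≤Cm _ _ _) j m^[1+x]≤2^j
    with m^[1+x]≤2^j⇒1≤j {b ∸ a} {x} {j} (≤-trans (s≤s 1≤c) c<m) m^[1+x]≤2^j
  ... | s≤s _ = ≤-trans w≤Cm (m≤m*n (C * (b ∸ a)) j)
  exec-within-budget (part-right c<m _ _ _ (_ , a≤r , r<b , _) after lower upper) =
    after-partition-within-budget a≤r r<b c<m after
      (exec-within-budget lower) (exec-within-budget upper)

lemma6 : ∀ (num den : ℕ) → 0 < num → num < den →
    ∀ (c : ℕ) → 3 ≤ c → ∀ (C : ℕ) →
    ∃[ K ] ∃[ N ] (∀ {A : Set} (_≺_ : A → A → Set) → StrictWeakOrder _≺_ →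
      ∀ (n : ℕ) → 1 ≤ n → N ≤ n → (X Y : Fin n → A) (w : ℕ) →
      PDQ.Exec _≺_ c num den C ⌊log₂ n ⌋ 0 n X Y w →
      w ≤ K * (n * ⌊log₂ n ⌋))
lemma6 num (suc x) 1≤num _ c 3≤c C = 2 * C * suc x , 2 , λ _≺_ _ n _ 2≤n _ _ w exec →
  let open GoodPartitionWork _≺_ c num x C (≤-trans (s≤s z≤n) 3≤c) 1≤num
      L = ⌊log₂ n ⌋
      1+L≤L+L = +-monoˡ-≤ L (2≤n⇒1≤⌊log₂n⌋ 2≤n)
  in begin
    w                          ≤⟨ exec-within-budget exec _ (n^k≤2^[k*[1+⌊log₂n⌋]] n (suc x)) ⟩
    C * n * (suc x * suc L)    ≤⟨ *-monoʳ-≤ (C * n) (*-monoʳ-≤ (suc x) 1+L≤L+L) ⟩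
    C * n * (suc x * (L + L))  ≡⟨ rearrange C n (suc x) L ⟩
    2 * C * suc x * (n * L)    ∎
  where
  open ≤-Reasoning
  rearrange : ∀ C n d L → C * n * (d * (L + L)) ≡ 2 * C * d * (n * L)
  rearrange = solve-∀
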